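{- Let $t\ge 4$ be an even integer and let $\mathcal{M}=(E_t,\mathcal{T})$ be a simple oriented matroid on the ground set $E_t=\{1,\dots,t\}$ with set of topes $\mathcal{T}\subseteq\{1,-1\}^t$. Let $\boldsymbol{D}=(D^0,D^1,\dots,D^{2t-1},D^0)$ be a symmetric cycle in the tope graph of $\mathcal{M}$, and let $\mathrm{S}(\boldsymbol{D})=(S^0,S^1,\dots,S^{2t-1})$ be the associated sequence of subtopes, $S^k=\tfrac12(D^k+D^{k+1})$ for $0\le k\le 2t-2$ and $S^{2t-1}=\tfrac12(D^{2t-1}+D^0)$. \begin{itemize} \item[(i)] If $T\in\mathcal{T}$ is a tope of $\mathcal{M}$, then there exist a unique subset $\overline{\boldsymbol{Q}}(T,\mathrm{S}(\boldsymbol{D}))$ of the set of subtopes in $\mathrm{S}(\boldsymbol{D})$ and a unique set of integers $\{\lambda_{Q'}: Q'\in\overline{\boldsymbol{Q}}(T,\mathrm{S}(\boldsymbol{D}))\}$ such that $$\sum_{Q'\in\overline{\boldsymbol{Q}}(T,\mathrm{S}(\boldsymbol{D}))}\lambda_{Q'}\, Q'=T,$$ where $|\overline{\boldsymbol{Q}}(T,\mathrm{S}(\boldsymbol{D}))|=t$, $1\le\lambda_{Q'}\le t-1$, and all the $\lambda_{Q'}$ are odd. \item[(ii)] If $S$ is a subtope of $\mathcal{M}$, then there exist a unique inclusion-minimal subset $\overline{\boldsymbol{Q}}(S,\mathrm{S}(\boldsymbol{D}))$ of the set of subtopes in $\mathrm{S}(\boldsymbol{D})$ and a unique set of integers $\{\lambda_{Q'}: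 Q'\in\overline{\boldsymbol{Q}}(S,\mathrm{S}(\boldsymbol{D}))\}$ such that $$\sum_{Q'\in\overline{\boldsymbol{Q}}(S,\mathrm{S}(\boldsymbol{D}))}\lambda_{Q'}\, Q'=S,$$ where $1\le\lambda_{Q'}\le t-1$. \end{itemize}
   Context: Oriented matroids are described by their sets of topes $\mathcal{T}\subseteq\{1,-1\}^t$ and covectors $\mathcal{L}\subseteq\{1,-1,0\}^t$, regarded as row vectors in $\mathbb{R}^t$. "Simple" here means the oriented matroid has no loops, no parallel and no antiparallel elements. The tope graph of $\mathcal{M}$ has the topes as vertices, two topes $T',T''$ being adjacent iff their Hamming distance is $1$ (equivalently $\langle T',T''\rangle=t-2$). For adjacent topes $T',T''$, their common subtope is their meet in the big face lattice, which equals $S=T'\wedge T''=\tfrac12(T'+T'')\in\{1,-1,0\}^t$; a subtope of $\mathcal{M}$ is any vector of this form. A symmetric cycle in the tope graph is a $2t$-cycle with vertex sequence $(D^0,D^1,\dots,D^{2t-1})$ such that $D^{k+t}=-D^k$ for $0\le k\le t-1$; consequently $S^{k+t}=-S^k$ for $0\le k\le t-1$. -}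

module Defs where

open import Data.Nat as ℕ using (ℕ; zero; suc; _<?_; _∸_)
open import Data.Integer as ℤ using (ℤ; +_; -[1+_])
open import Data.Fin as Fin using (Fin; zero; suc; toℕ; fromℕ<; _↑ˡ_; _↑ʳ_)
open import Data.Fin.Subset using (Subset; ∣_∣)
open import Data.Vec using (Vec; lookup; zipWith; map; tabulate)
open import Data.Bool using (Bool; true; false; not)
open import Data.Product using (Σ; ∃; _×_; _,_)
open import Data.Sum using (_⊎_)
open import Relation.Binary.PropositionalEquality using (_≡_; _≢_)
open import Relation.Nullary using (yes; no; ¬_)

data Sign : Set where
  ⊕ ⊖ 𝟘 : Sign

negS : Sign → Sign
negS ⊕ = ⊖
negS ⊖ = ⊕
negS 𝟘 = 𝟘

toℤ : Sign → ℤ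
toℤ ⊕ = + 1
toℤ ⊖ = -[1+ 0 ]
toℤ 𝟘 = + 0

SignVec : ℕ → Set
SignVec t = Vec Sign t

neg : ∀ {t} → SignVec t → SignVec t
neg = map negS

compS : Sign → Sign → Sign
compS 𝟘 b = b
compS ⊕ _ = ⊕
compS ⊖ _ = ⊖

comp : ∀ {t} → SignVec t → SignVec t → SignVec t
comp = zipWith compS

record OrientedMatroid (t : ℕ) : Set₁ where
  field
    Covector : SignVec t → Set
    L0 : Covector (tabulate (λ _ → 𝟘))
    L1 : ∀ X → Covector X → Covector (neg X)
    L2 : ∀ X Y → Covector X → Covector Y → Covector (comp X Y)
    L3 : ∀ X Y → Covector X → Covector Y → (e : Fin t) →
         lookup X e ≢ 𝟘 → lookup Y e ≡ negS (lookup X e) →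
         ∃ λ Z → Covector Z × lookup Z e ≡ 𝟘 ×
           (∀ f → ¬ (lookup X f ≢ 𝟘 × lookup Y f ≡ negS (lookup X f)) →
                  lookup Z f ≡ lookup (comp X Y) f)

open OrientedMatroid public

-- simple: no loops, no parallel and no antiparallel elements
Simple : ∀ {t} → OrientedMatroid t → Set
Simple {t} M =
  (∀ e → ∃ λ X → Covector M X × lookup X e ≢ 𝟘) ×
  (∀ e f → e ≢ f →
     (∃ λ X → Covector M X × lookup X e ≢ lookup X f) ×
     (∃ λ X → Covector M X × lookup X e ≢ negS (lookup X f)))

-- topes: the covectors in {1,-1}^t (the maximal covectors of a loopless OM)
Tope : ∀ {t} → OrientedMatroid t → SignVec t → Set
Tope M T = Covector M T × (∀ e → lookup T e ≢ 𝟘)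

Adjacent : ∀ {t} → SignVec t → SignVec t → Set
Adjacent {t} T₁ T₂ = ∃ λ (e : Fin t) →
  lookup T₁ e ≢ lookup T₂ e × (∀ f → f ≢ e → lookup T₁ f ≡ lookup T₂ f)

-- meet of two topes: (T' + T'')/2 for vectors in {1,-1}^t
meetS : Sign → Sign → Sign
meetS ⊕ ⊕ = ⊕
meetS ⊖ ⊖ = ⊖
meetS _ _ = 𝟘

meet : ∀ {t} → SignVec t → SignVec t → SignVec t
meet = zipWith meetS

Subtope : ∀ {t} → OrientedMatroid t → SignVec t → Set
Subtope M S = ∃ λ T₁ → ∃ λ T₂ →
  Tope M T₁ × Tope M T₂ × Adjacent T₁ T₂ × S ≡ meet T₁ T₂

csuc : ∀ {n} → Fin n → Fin n
csuc {suc n} i with suc (toℕ i) <? suc n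
... | yes p = fromℕ< p
... | no _  = zero

SymmetricCycle : ∀ {t} → OrientedMatroid t → (Fin (t ℕ.+ t) → SignVec t) → Set
SymmetricCycle {t} M D =
  (∀ k → Tope M (D k)) ×
  (∀ k → Adjacent (D k) (D (csuc k))) ×
  (∀ j k → D j ≡ D k → j ≡ k) ×
  (∀ (k : Fin t) → D (t ↑ʳ k) ≡ neg (D (k ↑ˡ t)))

subtopeSeq : ∀ {t} → (Fin (t ℕ.+ t) → SignVec t) → Fin (t ℕ.+ t) → SignVec t
subtopeSeq D k = meet (D k) (D (csuc k))

-- Linear combinations of the S^k.  A pair (Q, {λ_Q'}) with Q ⊆ S(D) and
-- λ_Q' ≥ 1 is encoded by a coefficient function c on the indices, with
-- Q = support of c (the S^k are pairwise distinct).

sumℤ : ∀ {n} → (Fin n → ℤ) → ℤ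
sumℤ {zero}  f = + 0
sumℤ {suc n} f = f zero ℤ.+ sumℤ (λ i → f (suc i))

Coeffs : ℕ → Set
Coeffs t = Fin (t ℕ.+ t) → ℕ

support : ∀ {t} → Coeffs t → Subset (t ℕ.+ t)
support c = tabulate (λ k → not (c k ℕ.≡ᵇ 0))

Represents : ∀ {t} → (Fin (t ℕ.+ t) → SignVec t) → Coeffs t → SignVec t → Set
Represents {t} D c X = ∀ (e : Fin t) →
  sumℤ (λ k → (+ c k) ℤ.* toℤ (lookup (subtopeSeq D k) e)) ≡ toℤ (lookup X e)

Bounded : ∀ {t} → Coeffs t → Set
Bounded {t} c = ∀ k → c k ≡ 0 ⊎ (1 ℕ.≤ c k × c k ℕ.≤ t ∸ 1)

SuppSub : ∀ {t} → Coeffs t → Coeffs t → Set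
SuppSub c' c = ∀ k → c' k ≢ 0 → c k ≢ 0

RepTope : ∀ {t} → (Fin (t ℕ.+ t) → SignVec t) → SignVec t → Coeffs t → Set
RepTope {t} D T c =
  Bounded {t} c × Represents D c T × ∣ support {t} c ∣ ≡ t ×
  (∀ k → c k ≢ 0 → c k ℕ.% 2 ≡ 1)

RepSub : ∀ {t} → (Fin (t ℕ.+ t) → SignVec t) → SignVec t → Coeffs t → Set
RepSub {t} D S c = Bounded {t} c × Represents D c S

MinimalRepSub : ∀ {t} → (Fin (t ℕ.+ t) → SignVec t) → SignVec t → Coeffs t → Set
MinimalRepSub {t} D S c =
  RepSub D S c × (∀ c' → RepSub D S c' → SuppSub {t} c' c → SuppSub {t} c c')

module Submission where

-- Walking along the symmetric cycle, D^t = -D^0, so each of the t elements changes sign during the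
-- first t steps, and since each step changes one sign, each element e changes sign exactly once,
-- at some step f(e).  Hence S^k_e = D^0_e · sign(f(e) - k) and S^{t+k} = -S^k for k < t, and
-- Σ_i c_i S^i = X becomes the system Σ_{k<t} b_k sign(m - k) = y_m (m < t) in the net coefficients
-- b_k = c_k - c_{t+k}, where y_{f(e)} = D^0_e X_e.  In prefix sums P_j = Σ_{k<j} b_k it reads
-- P_m + P_{m+1} - P_t = y_m, which for even t has the unique solution
-- P_j = -(-1)^j W_j - [j odd] W_t with W_j = Σ_{m<j} (-1)^m y_m.  So b_k = ±(W_k - (W_t - W_{k+1}))
-- is a signed sum of t - 1 of the y_m: |b_k| ≤ t - 1, and b_k is odd when X is a tope.  A
-- representation is a choice of c with these net coefficients; putting |b_k| on S^k or S^{t+k}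
-- according to the sign of b_k gives the support contained in every other one, and for a tope a
-- support of size t (one element per pair, as every b_k ≠ 0) forces this choice as well.

open import Defs
open import Data.Nat using (ℕ; _≤_; _+_; _%_)
open import Data.Fin using (Fin)
open import Data.Product using (Σ; ∃; _×_)
open import Relation.Binary.PropositionalEquality using (_≡_)

open import Algebra.Bundles using (Monoid)
open import Data.Bool using (not)
open import Data.Empty using (⊥-elim)
open import Data.Fin as Fin using (zero; suc; toℕ; fromℕ<; _↑ˡ_; _↑ʳ_; splitAt; punchOut)
import Data.Fin.Properties as Fin
open import Data.Fin.Subset using (∣_∣)
open import Data.Integer as ℤ using (ℤ; +_; -[1+_]; 0ℤ; 1ℤ; -1ℤ; _-_; -_; _^_)
import Data.Integer.Properties as ℤ
open import Data.Integer.Tactic.RingSolver using (solve-∀; solve)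
open import Data.List using (_∷_; [])
open import Data.Nat as ℕ using (zero; suc; _∸_; _*_; _/_; z≤n; s≤s)
import Data.Nat.Properties as ℕ
open import Data.Nat.DivMod using (m≡m%n+[m/n]*n; [m+kn]%n≡m%n)
open import Data.Product using (∃₂; _,_; proj₁; proj₂)
open import Data.Sum using (_⊎_; inj₁; inj₂; [_,_]′)
open import Data.Vec as Vec using (lookup; tabulate)
import Data.Vec.Properties as Vec
open import Data.Vec.Functional using (_++_)
open import Data.Vec.Functional.Properties using (lookup-++ˡ; lookup-++ʳ)
open import Function using (_∘_; _∘′_)
open import Function.Definitions using (Injective)
open import Relation.Binary.Definitions using (tri<; tri≈; tri>)
open import Relation.Binary.PropositionalEquality
  using (_≢_; refl; sym; trans; cong; cong₂; subst; subst₂; module ≡-Reasoning)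
open import Relation.Nullary using (yes; no)
import Algebra.Properties.CommutativeMonoid.Sum ℕ.+-0-commutativeMonoid as ℕΣ
import Algebra.Properties.Monoid.Sum as MonoidΣ
import Algebra.Properties.Semiring.Sum ℤ.+-*-semiring as ℤΣ

negS-involutive : ∀ a → negS (negS a) ≡ a
negS-involutive ⊕ = refl
negS-involutive ⊖ = refl
negS-involutive 𝟘 = refl

neg-involutive : ∀ {t} (v : SignVec t) → neg (neg v) ≡ v
neg-involutive Vec.[]        = refl
neg-involutive (a Vec.∷ v) = cong₂ Vec._∷_ (negS-involutive a) (neg-involutive v)

meetS-negS : ∀ a b → meetS (negS a) (negS b) ≡ negS (meetS a b)
meetS-negS ⊕ ⊕ = refl
meetS-negS ⊕ ⊖ = refl
meetS-negS ⊕ 𝟘 = refl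
meetS-negS ⊖ ⊕ = refl
meetS-negS ⊖ ⊖ = refl
meetS-negS ⊖ 𝟘 = refl
meetS-negS 𝟘 ⊕ = refl
meetS-negS 𝟘 ⊖ = refl
meetS-negS 𝟘 𝟘 = refl

meet-neg : ∀ {t} (u v : SignVec t) → meet (neg u) (neg v) ≡ neg (meet u v)
meet-neg Vec.[]        Vec.[]        = refl
meet-neg (a Vec.∷ u) (b Vec.∷ v) = cong₂ Vec._∷_ (meetS-negS a b) (meet-neg u v)

meetS-idem : ∀ a → meetS a a ≡ a
meetS-idem ⊕ = refl
meetS-idem ⊖ = refl
meetS-idem 𝟘 = refl

meetS-negSʳ : ∀ a → meetS a (negS a) ≡ 𝟘
meetS-negSʳ ⊕ = refl
meetS-negSʳ ⊖ = refl
meetS-negSʳ 𝟘 = refl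

toℤ-negS : ∀ a → toℤ (negS a) ≡ - toℤ a
toℤ-negS ⊕ = refl
toℤ-negS ⊖ = refl
toℤ-negS 𝟘 = refl

negS≢ : ∀ {a} → a ≢ 𝟘 → negS a ≢ a
negS≢ {⊕} _   ()
negS≢ {⊖} _   ()
negS≢ {𝟘} a≢𝟘 _ = a≢𝟘 refl

nonzero-≢⇒negS : ∀ {a b} → a ≢ 𝟘 → b ≢ 𝟘 → a ≢ b → b ≡ negS a
nonzero-≢⇒negS {⊕} {⊕} _ _ a≢b = ⊥-elim (a≢b refl)
nonzero-≢⇒negS {⊕} {⊖} _ _ _   = refl
nonzero-≢⇒negS {⊖} {⊕} _ _ _   = refl
nonzero-≢⇒negS {⊖} {⊖} _ _ a≢b = ⊥-elim (a≢b refl)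
nonzero-≢⇒negS {𝟘}     a≢𝟘 _ _ = ⊥-elim (a≢𝟘 refl)
nonzero-≢⇒negS {⊕} {𝟘} _ b≢𝟘 _ = ⊥-elim (b≢𝟘 refl)
nonzero-≢⇒negS {⊖} {𝟘} _ b≢𝟘 _ = ⊥-elim (b≢𝟘 refl)

toℕ-csuc : ∀ {m} (i : Fin m) → suc (toℕ i) ℕ.< m → toℕ (csuc i) ≡ suc (toℕ i)
toℕ-csuc {suc m} i i+1<m with suc (toℕ i) ℕ.<? suc m
... | yes p = Fin.toℕ-fromℕ< p
... | no ¬p = ⊥-elim (¬p i+1<m)

csuc-last : ∀ {m} (i : Fin (suc m)) → toℕ i ≡ m → csuc i ≡ zero
csuc-last {m} i i≡m with suc (toℕ i) ℕ.<? suc m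
... | yes p = ⊥-elim (ℕ.<⇒≢ (ℕ.s≤s⁻¹ p) i≡m)
... | no _  = refl

cyclic : ∀ {m} → ℕ → Fin (suc m)
cyclic zero    = zero
cyclic (suc k) = csuc (cyclic k)

toℕ-cyclic : ∀ {m} k → k ℕ.< suc m → toℕ (cyclic {m} k) ≡ k
toℕ-cyclic zero    _     = refl
toℕ-cyclic {m} (suc k) k+1<m =
  trans (toℕ-csuc (cyclic k) (subst (λ j → suc j ℕ.< suc m) (sym ih) k+1<m)) (cong suc ih)
  where
  ih : toℕ (cyclic {m} k) ≡ k
  ih = toℕ-cyclic k (ℕ.<-trans (ℕ.n<1+n k) k+1<m)

cyclic-wrap : ∀ {m} → cyclic {m} (suc m) ≡ zero
cyclic-wrap {m} = csuc-last (cyclic m) (toℕ-cyclic m ℕ.≤-refl)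

-- g is injective, so by pigeonhole it is onto
section⇒retraction : ∀ {n} (f g : Fin n → Fin n) → (∀ x → f (g x) ≡ x) → ∀ y → g (f y) ≡ y
section⇒retraction f g fg y with Fin.any? (λ x → g x Fin.≟ y)
... | yes (x , gx≡y) = subst (λ z → g (f z) ≡ z) gx≡y (cong g (fg x))
section⇒retraction {suc n} f g fg y | no y∉img = ⊥-elim (ℕ.1+n≰n (Fin.injective⇒≤ g′-injective))
  where
  g′ : Fin (suc n) → Fin n
  g′ x = punchOut {i = y} {j = g x} (λ y≡gx → y∉img (x , sym y≡gx))
  g′-injective : Injective _≡_ _≡_ g′
  g′-injective {x} {x′} eq = trans (sym (fg x)) (trans (cong f (Fin.punchOut-injective {i = y} _ _ eq)) (fg x′))

prefixSum : ℕ → (ℕ → ℤ) → ℤ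
prefixSum zero    f = 0ℤ
prefixSum (suc n) f = prefixSum n f ℤ.+ f n

isOddℤ : ℕ → ℤ
isOddℤ zero    = 0ℤ
isOddℤ (suc k) = 1ℤ - isOddℤ k

SignAndParity : ℤ → ℤ → Set
SignAndParity s o = (s ≡ 1ℤ × o ≡ 0ℤ) ⊎ (s ≡ -1ℤ × o ≡ 1ℤ)

parity : ∀ k → SignAndParity (-1ℤ ^ k) (isOddℤ k)
parity zero = inj₁ (refl , refl)
parity (suc k) with parity k
... | inj₁ (p , q) rewrite p | q = inj₂ (refl , refl)
... | inj₂ (p , q) rewrite p | q = inj₁ (refl , refl)

isOddℤ-even : ∀ h → isOddℤ (h ℕ.* 2) ≡ 0ℤ
isOddℤ-even zero    = refl
isOddℤ-even (suc h) rewrite isOddℤ-even h = refl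

sign[_-_] : ℕ → ℕ → ℤ
sign[ zero  - zero  ] = 0ℤ
sign[ suc m - zero  ] = 1ℤ
sign[ zero  - suc k ] = -1ℤ
sign[ suc m - suc k ] = sign[ m - k ]

sign-< : ∀ {m k} → k ℕ.< m → sign[ m - k ] ≡ 1ℤ
sign-< {suc m} {zero}  _         = refl
sign-< {suc m} {suc k} (s≤s k<m) = sign-< k<m

sign-≡ : ∀ m → sign[ m - m ] ≡ 0ℤ
sign-≡ zero    = refl
sign-≡ (suc m) = sign-≡ m

sign-> : ∀ {m k} → m ℕ.< k → sign[ m - k ] ≡ -1ℤ
sign-> {zero}  {suc k} _         = refl
sign-> {suc m} {suc k} (s≤s m<k) = sign-> m<k

-- the m-th coordinate of ∑_{k<t} b_k S^k, in the coordinates in which S^k = (sign[ m - k ])_m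
signedSum : ℕ → (ℕ → ℤ) → ℕ → ℤ
signedSum t b m = prefixSum t (λ k → b k ℤ.* sign[ m - k ])

signedSum-≤ : ∀ t b {m} → t ℕ.≤ m → signedSum t b m ≡ prefixSum t b
signedSum-≤ zero    b _   = refl
signedSum-≤ (suc t) b t<m =
  cong₂ ℤ._+_ (signedSum-≤ t b (ℕ.<⇒≤ t<m)) (trans (cong (b t ℤ.*_) (sign-< t<m)) (ℤ.*-identityʳ (b t)))

signedSum≡prefixSums : ∀ t b {m} → m ℕ.< t →
  signedSum t b m ≡ prefixSum m b ℤ.+ prefixSum (suc m) b - prefixSum t b
signedSum≡prefixSums (suc t) b {m} (s≤s m≤t) with ℕ.m≤n⇒m<n∨m≡n m≤t
... | inj₂ refl rewrite signedSum-≤ m b ℕ.≤-refl | sign-≡ m = diagonal (prefixSum m b) (b m)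
  where
  diagonal : ∀ p x → p ℤ.+ x ℤ.* 0ℤ ≡ p ℤ.+ (p ℤ.+ x) - (p ℤ.+ x)
  diagonal = solve-∀
... | inj₁ m<t rewrite signedSum≡prefixSums t b m<t | sign-> m<t =
  below (prefixSum m b) (prefixSum (suc m) b) (prefixSum t b) (b t)
  where
  below : ∀ p q r x → p ℤ.+ q - r ℤ.+ x ℤ.* -1ℤ ≡ p ℤ.+ q - (r ℤ.+ x)
  below = solve-∀

alternatingSum : (ℕ → ℤ) → ℕ → ℤ
alternatingSum y j = prefixSum j (λ m → -1ℤ ^ m ℤ.* y m)

-- P_j = ∑_{k<j} b_k for the unique solution b of signedSum t b ≡ y when t is even
solutionPrefix : (ℕ → ℤ) → ℕ → ℕ → ℤ
solutionPrefix y t j = - (-1ℤ ^ j ℤ.* alternatingSum y j) - isOddℤ j ℤ.* alternatingSum y t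

solution : (ℕ → ℤ) → ℕ → ℕ → ℤ
solution y t k = solutionPrefix y t (suc k) - solutionPrefix y t k

even-sign : ∀ t → isOddℤ t ≡ 0ℤ → -1ℤ ^ t ≡ 1ℤ
even-sign t even with parity t
... | inj₁ (s , _) = s
... | inj₂ (_ , o) with () ← trans (sym o) even

solutionPrefix-last : ∀ y t → isOddℤ t ≡ 0ℤ → solutionPrefix y t t ≡ - alternatingSum y t
solutionPrefix-last y t even = lastValue (even-sign t even) even (alternatingSum y t)
  where
  lastValue : ∀ {s o} → s ≡ 1ℤ → o ≡ 0ℤ → ∀ v → - (s ℤ.* v) - o ℤ.* v ≡ - v
  lastValue refl refl = solve-∀

solutionPrefix-recurrence : ∀ y t → isOddℤ t ≡ 0ℤ → ∀ m →
  solutionPrefix y t m ℤ.+ solutionPrefix y t (suc m) - solutionPrefix y t t ≡ y m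
solutionPrefix-recurrence y t even m =
  trans (cong (_-_ (solutionPrefix y t m ℤ.+ solutionPrefix y t (suc m))) (solutionPrefix-last y t even))
        (step (parity m) (alternatingSum y m) (alternatingSum y t) (y m))
  where
  step : ∀ {s o} → SignAndParity s o → ∀ w v x →
    - (s ℤ.* w) - o ℤ.* v ℤ.+ (- (-1ℤ ℤ.* s ℤ.* (w ℤ.+ s ℤ.* x)) - (1ℤ - o) ℤ.* v) - - v ≡ x
  step (inj₁ (refl , refl)) = solve-∀
  step (inj₂ (refl , refl)) = solve-∀

prefixSum-solution : ∀ y t j → prefixSum j (solution y t) ≡ solutionPrefix y t j
prefixSum-solution y t zero = base (alternatingSum y t)
  where
  base : ∀ w → 0ℤ ≡ - (1ℤ ℤ.* 0ℤ) - 0ℤ ℤ.* w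
  base = solve-∀
prefixSum-solution y t (suc j) rewrite prefixSum-solution y t j =
  telescope (solutionPrefix y t j) (solutionPrefix y t (suc j))
  where
  telescope : ∀ p q → p ℤ.+ (q - p) ≡ q
  telescope = solve-∀

solution-solves : ∀ y t → isOddℤ t ≡ 0ℤ → ∀ {m} → m ℕ.< t → signedSum t (solution y t) m ≡ y m
solution-solves y t even {m} m<t = begin
  signedSum t (solution y t) m
    ≡⟨ signedSum≡prefixSums t (solution y t) m<t ⟩
  prefixSum m (solution y t) ℤ.+ prefixSum (suc m) (solution y t) - prefixSum t (solution y t)
    ≡⟨ cong₂ _-_ (cong₂ ℤ._+_ (prefixSum-solution y t m) (prefixSum-solution y t (suc m)))
                 (prefixSum-solution y t t) ⟩
  solutionPrefix y t m ℤ.+ solutionPrefix y t (suc m) - solutionPrefix y t t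
    ≡⟨ solutionPrefix-recurrence y t even m ⟩
  y m ∎
  where open ≡-Reasoning

prefixSum-any-solution : ∀ y t b → (∀ {m} → m ℕ.< t → signedSum t b m ≡ y m) → ∀ {j} → j ℕ.≤ t →
  prefixSum j b ≡ - (-1ℤ ^ j ℤ.* alternatingSum y j) ℤ.+ isOddℤ j ℤ.* prefixSum t b
prefixSum-any-solution y t b solves {zero} _ = base (prefixSum t b)
  where
  base : ∀ r → 0ℤ ≡ - (1ℤ ℤ.* 0ℤ) ℤ.+ 0ℤ ℤ.* r
  base = solve-∀
prefixSum-any-solution y t b solves {suc j} j<t =
  step (parity j) (alternatingSum y j) (prefixSum t b) (b j)
       (prefixSum-any-solution y t b solves (ℕ.<⇒≤ j<t))
       (trans (sym (signedSum≡prefixSums t b j<t)) (solves j<t))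
  where
  step : ∀ {s o} → SignAndParity s o → ∀ w r x {p z} → p ≡ - (s ℤ.* w) ℤ.+ o ℤ.* r →
    p ℤ.+ (p ℤ.+ x) - r ≡ z → p ℤ.+ x ≡ - (-1ℤ ℤ.* s ℤ.* (w ℤ.+ s ℤ.* z)) ℤ.+ (1ℤ - o) ℤ.* r
  step (inj₁ (refl , refl)) w r x refl refl = solve (w ∷ r ∷ x ∷ [])
  step (inj₂ (refl , refl)) w r x refl refl = solve (w ∷ r ∷ x ∷ [])

prefixSum-unique : ∀ y t b → isOddℤ t ≡ 0ℤ → (∀ {m} → m ℕ.< t → signedSum t b m ≡ y m) →
  ∀ {j} → j ℕ.≤ t → prefixSum j b ≡ solutionPrefix y t j
prefixSum-unique y t b even solves {j} j≤t =
  eliminate (-1ℤ ^ j) (isOddℤ j) (alternatingSum y j) (atEnd (even-sign t even) even (prefixSum-any-solution y t b solves ℕ.≤-refl))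
            (prefixSum-any-solution y t b solves j≤t)
  where
  atEnd : ∀ {s o w r} → s ≡ 1ℤ → o ≡ 0ℤ → r ≡ - (s ℤ.* w) ℤ.+ o ℤ.* r → r ≡ - w
  atEnd {w = w} {r} refl refl eq = trans eq (solve (w ∷ r ∷ []))
  eliminate : ∀ s o x {w r p} → r ≡ - w → p ≡ - (s ℤ.* x) ℤ.+ o ℤ.* r → p ≡ - (s ℤ.* x) - o ℤ.* w
  eliminate s o x {w} refl refl = solve (s ∷ o ∷ x ∷ w ∷ [])

solution-unique : ∀ y t b → isOddℤ t ≡ 0ℤ → (∀ {m} → m ℕ.< t → signedSum t b m ≡ y m) →
  ∀ {k} → k ℕ.< t → b k ≡ solution y t k
solution-unique y t b even solves {k} k<t = begin
  b k                                     ≡⟨ difference (prefixSum k b) (b k) ⟩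
  prefixSum (suc k) b - prefixSum k b     ≡⟨ cong₂ _-_ (prefixSum-unique y t b even solves k<t)
                                                       (prefixSum-unique y t b even solves (ℕ.<⇒≤ k<t)) ⟩
  solution y t k                          ∎
  where
  open ≡-Reasoning
  difference : ∀ p x → x ≡ p ℤ.+ x - p
  difference = solve-∀

solution≡alternating : ∀ y t k →
  solution y t k ≡ -1ℤ ^ k ℤ.* (alternatingSum y k - (alternatingSum y t - alternatingSum y (suc k)))
solution≡alternating y t k = step (parity k) (alternatingSum y k) (alternatingSum y t) (y k)
  where
  step : ∀ {s o} → SignAndParity s o → ∀ w v x →
    - (-1ℤ ℤ.* s ℤ.* (w ℤ.+ s ℤ.* x)) - (1ℤ - o) ℤ.* v - (- (s ℤ.* w) - o ℤ.* v)
      ≡ s ℤ.* (w - (v - (w ℤ.+ s ℤ.* x)))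
  step (inj₁ (refl , refl)) = solve-∀
  step (inj₂ (refl , refl)) = solve-∀

prefixSum-cong : ∀ n {f g} → (∀ {k} → k ℕ.< n → f k ≡ g k) → prefixSum n f ≡ prefixSum n g
prefixSum-cong zero    f≗g = refl
prefixSum-cong (suc n) f≗g = cong₂ ℤ._+_ (prefixSum-cong n (f≗g ∘′ ℕ.m<n⇒m<1+n)) (f≗g ℕ.≤-refl)

signedSum-cong : ∀ t {b b′} m → (∀ {k} → k ℕ.< t → b k ≡ b′ k) → signedSum t b m ≡ signedSum t b′ m
signedSum-cong t m b≗b′ = prefixSum-cong t (λ k<t → cong (ℤ._* _) (b≗b′ k<t))

data SumOf (U : ℤ → Set) : ℕ → ℤ → Set where
  []  : SumOf U 0 0ℤ
  _∷_ : ∀ {n x u} → U u → SumOf U n x → SumOf U (suc n) (x ℤ.+ u)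

module _ {U : ℤ → Set} (U-neg : ∀ {u} → U u → U (- u)) where

  SumOf-neg : ∀ {n x} → SumOf U n x → SumOf U n (- x)
  SumOf-neg []                 = []
  SumOf-neg (_∷_ {x = x} {u} p xs) =
    subst (SumOf U _) (sym (ℤ.neg-distrib-+ x u)) (U-neg p ∷ SumOf-neg xs)

  U-sign : ∀ k {u} → U u → U (-1ℤ ^ k ℤ.* u)
  U-sign k {u} p with parity k
  ... | inj₁ (s , _) rewrite s = subst U (sym (ℤ.*-identityˡ u)) p
  ... | inj₂ (s , _) rewrite s = subst U (sym (ℤ.-1*i≡-i u)) (U-neg p)

  SumOf-sign : ∀ k {n x} → SumOf U n x → SumOf U n (-1ℤ ^ k ℤ.* x)
  SumOf-sign k {x = x} xs with parity k
  ... | inj₁ (s , _) rewrite s = subst (SumOf U _) (sym (ℤ.*-identityˡ x)) xs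
  ... | inj₂ (s , _) rewrite s = subst (SumOf U _) (sym (ℤ.-1*i≡-i x)) (SumOf-neg xs)

  SumOf-+ : ∀ {n m x z} → SumOf U n x → SumOf U m z → SumOf U (n ℕ.+ m) (x ℤ.+ z)
  SumOf-+ {z = z} []       zs = subst (SumOf U _) (sym (ℤ.+-identityˡ z)) zs
  SumOf-+ {z = z} (_∷_ {x = x} {u} p xs) zs =
    subst (SumOf U _) (swap x u z) (p ∷ SumOf-+ xs zs)
    where
    swap : ∀ x u z → x ℤ.+ z ℤ.+ u ≡ x ℤ.+ u ℤ.+ z
    swap = solve-∀

  SumOf-- : ∀ {n m x z} → SumOf U n x → SumOf U m z → SumOf U (n ℕ.+ m) (x - z)
  SumOf-- xs zs = SumOf-+ xs (SumOf-neg zs)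

SumOf-range : ∀ {U} {f : ℕ → ℤ} → (∀ m → U (f m)) → ∀ d i → SumOf U d (prefixSum (d ℕ.+ i) f - prefixSum i f)
SumOf-range {U} {f} Uf zero    i = subst (SumOf U 0) (sym (ℤ.+-inverseʳ (prefixSum i f))) []
SumOf-range {U} {f} Uf (suc d) i =
  subst (SumOf U (suc d)) (shift (prefixSum (d ℕ.+ i) f) (prefixSum i f) (f (d ℕ.+ i)))
        (Uf (d ℕ.+ i) ∷ SumOf-range Uf d i)
  where
  shift : ∀ p q x → p - q ℤ.+ x ≡ p ℤ.+ x - q
  shift = solve-∀

SumOf-solution : ∀ {U y} → (∀ {u} → U u → U (- u)) → (∀ m → U (y m)) →
  ∀ {t k} → k ℕ.< t → SumOf U (t ∸ 1) (solution y t k)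
SumOf-solution {U} {y} U-neg Uy {t} {k} k<t =
  subst₂ (SumOf U) (count k<t) (sym (solution≡alternating y t k))
    (SumOf-sign {U} U-neg k (SumOf-- {U} U-neg before after))
  where
  Ug : ∀ m → U (-1ℤ ^ m ℤ.* y m)
  Ug m = U-sign {U} U-neg m (Uy m)
  before : SumOf U k (alternatingSum y k)
  before = subst (λ n → SumOf U k (prefixSum n _)) (ℕ.+-identityʳ k)
             (subst (SumOf U k) (ℤ.+-identityʳ _) (SumOf-range Ug k 0))
  after : SumOf U (t ∸ suc k) (alternatingSum y t - alternatingSum y (suc k))
  after = subst (λ n → SumOf U (t ∸ suc k) (prefixSum n _ - _)) (ℕ.m∸n+n≡m k<t) (SumOf-range Ug (t ∸ suc k) (suc k))
  count : ∀ {k t} → k ℕ.< t → k ℕ.+ (t ∸ suc k) ≡ t ∸ 1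
  count (s≤s k≤t) = ℕ.m+[n∸m]≡n k≤t

IsUnit : ℤ → Set
IsUnit u = u ≡ 1ℤ ⊎ u ≡ -1ℤ

IsSign : ℤ → Set
IsSign u = IsUnit u ⊎ u ≡ 0ℤ

isUnit-neg : ∀ {u} → IsUnit u → IsUnit (- u)
isUnit-neg (inj₁ refl) = inj₂ refl
isUnit-neg (inj₂ refl) = inj₁ refl

isSign-neg : ∀ {u} → IsSign u → IsSign (- u)
isSign-neg (inj₁ p)    = inj₁ (isUnit-neg p)
isSign-neg (inj₂ refl) = inj₂ refl

SumOf-units : ∀ {n x} → SumOf IsUnit n x → ∃₂ λ a b → a ℕ.+ b ≡ n × x ≡ + a - + b
SumOf-units [] = 0 , 0 , refl , refl
SumOf-units (inj₁ refl ∷ xs) with a , b , a+b≡n , refl ← SumOf-units xs =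
  suc a , b , cong suc a+b≡n , up (+ a) (+ b)
  where
  up : ∀ a b → a - b ℤ.+ 1ℤ ≡ 1ℤ ℤ.+ a - b
  up = solve-∀
SumOf-units (inj₂ refl ∷ xs) with a , b , a+b≡n , refl ← SumOf-units xs =
  a , suc b , trans (ℕ.+-suc a b) (cong suc a+b≡n) , down (+ a) (+ b)
  where
  down : ∀ a b → a - b ℤ.+ -1ℤ ≡ a - (1ℤ ℤ.+ b)
  down = solve-∀

SumOf-signs : ∀ {n x} → SumOf IsSign n x → ℤ.∣ x ∣ ℕ.≤ n
SumOf-signs []                          = z≤n
SumOf-signs (_∷_ {n} {x} {u} p xs) = ℕ.≤-trans (ℤ.∣i+j∣≤∣i∣+∣j∣ x u)
  (ℕ.≤-trans (ℕ.+-mono-≤ (SumOf-signs xs) (∣sign∣≤1 p)) (ℕ.≤-reflexive (ℕ.+-comm n 1)))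
  where
  ∣sign∣≤1 : ∀ {u} → IsSign u → ℤ.∣ u ∣ ℕ.≤ 1
  ∣sign∣≤1 (inj₁ (inj₁ refl)) = ℕ.≤-refl
  ∣sign∣≤1 (inj₁ (inj₂ refl)) = ℕ.≤-refl
  ∣sign∣≤1 (inj₂ refl)        = z≤n

posPart : ℤ → ℕ
posPart (+ n)    = n
posPart -[1+ n ] = 0

negPart : ℤ → ℕ
negPart (+ n)    = 0
negPart -[1+ n ] = suc n

posPart-negPart : ∀ x → x ≡ + posPart x - + negPart x
posPart-negPart (+ n)    = sym (ℤ.+-identityʳ (+ n))
posPart-negPart -[1+ n ] = refl

posPart≡0⊎negPart≡0 : ∀ x → posPart x ≡ 0 ⊎ negPart x ≡ 0
posPart≡0⊎negPart≡0 (+ n)    = inj₂ refl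
posPart≡0⊎negPart≡0 -[1+ n ] = inj₁ refl

posPart≤∣x∣ : ∀ x → posPart x ℕ.≤ ℤ.∣ x ∣
posPart≤∣x∣ (+ n)    = ℕ.≤-refl
posPart≤∣x∣ -[1+ n ] = z≤n

negPart≤∣x∣ : ∀ x → negPart x ℕ.≤ ℤ.∣ x ∣
negPart≤∣x∣ (+ n)    = z≤n
negPart≤∣x∣ -[1+ n ] = ℕ.≤-refl

posPart-neg : ∀ n → posPart (- + n) ≡ 0
posPart-neg zero    = refl
posPart-neg (suc n) = refl

negPart-neg : ∀ n → negPart (- + n) ≡ n
negPart-neg zero    = refl
negPart-neg (suc n) = refl

parts-of-difference : ∀ a b → posPart (+ a - + b) ≡ a ∸ b × negPart (+ a - + b) ≡ b ∸ a
parts-of-difference a b rewrite ℤ.[+m]-[+n]≡m⊖n a b with ℕ.≤-total b a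
... | inj₁ b≤a rewrite ℤ.⊖-≥ b≤a = refl , sym (ℕ.m≤n⇒m∸n≡0 b≤a)
... | inj₂ a≤b rewrite ℤ.⊖-≤ a≤b = trans (posPart-neg (b ∸ a)) (sym (ℕ.m≤n⇒m∸n≡0 a≤b)) , negPart-neg (b ∸ a)

parts-unique : ∀ {x a b} → a ≡ 0 ⊎ b ≡ 0 → x ≡ + a - + b → posPart x ≡ a × negPart x ≡ b
parts-unique {a = a} {b} a≡0⊎b≡0 refl with parts-of-difference a b
parts-unique {a = a} {b} (inj₁ refl) refl | p , n = trans p (ℕ.0∸n≡0 b) , n
parts-unique {a = a} {b} (inj₂ refl) refl | p , n = p , trans n (ℕ.0∸n≡0 a)

parts-≤ : ∀ a b {x} → x ≡ + a - + b → posPart x ℕ.≤ a × negPart x ℕ.≤ b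
parts-≤ a b refl with p , n ← parts-of-difference a b =
  ℕ.≤-trans (ℕ.≤-reflexive p) (ℕ.m∸n≤m a b) , ℕ.≤-trans (ℕ.≤-reflexive n) (ℕ.m∸n≤m b a)

∸-parity : ∀ {a b} → b ℕ.≤ a → (a ∸ b) % 2 ≡ (a ℕ.+ b) % 2
∸-parity {a} {b} b≤a = trans (sym ([m+kn]%n≡m%n (a ∸ b) b 2)) (cong (_% 2) (begin
  a ∸ b ℕ.+ b ℕ.* 2       ≡⟨ cong (a ∸ b ℕ.+_) (ℕ.*-comm b 2) ⟩
  a ∸ b ℕ.+ (b ℕ.+ (b ℕ.+ 0)) ≡⟨ cong (λ c → a ∸ b ℕ.+ (b ℕ.+ c)) (ℕ.+-identityʳ b) ⟩
  a ∸ b ℕ.+ (b ℕ.+ b)     ≡⟨ ℕ.+-assoc (a ∸ b) b b ⟨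
  a ∸ b ℕ.+ b ℕ.+ b       ≡⟨ cong (ℕ._+ b) (ℕ.m∸n+n≡m b≤a) ⟩
  a ℕ.+ b                 ∎))
  where open ≡-Reasoning

OneOddOneZero : ℕ → ℕ → Set
OneOddOneZero p m = (p % 2 ≡ 1 × m ≡ 0) ⊎ (m % 2 ≡ 1 × p ≡ 0)

SumOf-odd-units : ∀ {n x} → SumOf IsUnit n x → n % 2 ≡ 1 → OneOddOneZero (posPart x) (negPart x)
SumOf-odd-units xs odd with SumOf-units xs
... | a , b , refl , refl with parts-of-difference a b | ℕ.≤-total b a
...   | p , n | inj₁ b≤a rewrite p | n =
  inj₁ (trans (∸-parity b≤a) odd , ℕ.m≤n⇒m∸n≡0 b≤a)
...   | p , n | inj₂ a≤b rewrite p | n =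
  inj₂ (trans (∸-parity a≤b) (trans (cong (_% 2) (ℕ.+-comm b a)) odd) , ℕ.m≤n⇒m∸n≡0 a≤b)

isUnit-* : ∀ {u v} → IsUnit u → IsUnit v → IsUnit (u ℤ.* v)
isUnit-* (inj₁ refl) (inj₁ refl) = inj₁ refl
isUnit-* (inj₁ refl) (inj₂ refl) = inj₂ refl
isUnit-* (inj₂ refl) (inj₁ refl) = inj₂ refl
isUnit-* (inj₂ refl) (inj₂ refl) = inj₁ refl

isUnit-*-isSign : ∀ {u v} → IsUnit u → IsSign v → IsSign (u ℤ.* v)
isUnit-*-isSign p (inj₁ q)    = inj₁ (isUnit-* p q)
isUnit-*-isSign {u} p (inj₂ refl) = inj₂ (ℤ.*-zeroʳ u)

module _ {a ℓ} (M : Monoid a ℓ) where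
  open Monoid M using (Carrier; _≈_; _∙_; setoid; identityˡ; assoc; ∙-congˡ) renaming (sym to ≈-sym)
  open MonoidΣ M using (sum)
  open import Relation.Binary.Reasoning.Setoid setoid

  sum-↑ : ∀ m {n} (f : Fin (m ℕ.+ n) → Carrier) → sum f ≈ sum (f ∘ (_↑ˡ n)) ∙ sum (f ∘ (m ↑ʳ_))
  sum-↑ zero    f = ≈-sym (identityˡ (sum f))
  sum-↑ (suc m) {n} f = begin
    f zero ∙ sum (f ∘ suc)                                         ≈⟨ ∙-congˡ (sum-↑ m (f ∘ suc)) ⟩
    f zero ∙ (sum (f ∘ suc ∘ (_↑ˡ n)) ∙ sum (f ∘ suc ∘ (m ↑ʳ_)))   ≈⟨ assoc _ _ _ ⟨
    f zero ∙ sum (f ∘ suc ∘ (_↑ˡ n)) ∙ sum (f ∘ suc ∘ (m ↑ʳ_))     ∎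

↑-elim : ∀ m {n} (P : Fin (m ℕ.+ n) → Set) → (∀ i → P (i ↑ˡ n)) → (∀ j → P (m ↑ʳ j)) → ∀ i → P i
↑-elim m P left right i with splitAt m i in eq
... | inj₁ k = subst P (Fin.splitAt⁻¹-↑ˡ eq) (left k)
... | inj₂ k = subst P (Fin.splitAt⁻¹-↑ʳ eq) (right k)

sumℤ≡sum : ∀ {n} (f : Fin n → ℤ) → sumℤ f ≡ ℤΣ.sum f
sumℤ≡sum {zero}  f = refl
sumℤ≡sum {suc n} f = cong (ℤ._+_ (f zero)) (sumℤ≡sum (f ∘ suc))

prefixSum-front : ∀ n (g : ℕ → ℤ) → prefixSum (suc n) g ≡ g 0 ℤ.+ prefixSum n (g ∘ suc)
prefixSum-front zero    g = trans (ℤ.+-identityˡ (g 0)) (sym (ℤ.+-identityʳ (g 0)))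
prefixSum-front (suc n) g = trans (cong (ℤ._+ g (suc n)) (prefixSum-front n g)) (ℤ.+-assoc (g 0) _ _)

sum-toℕ : ∀ n (g : ℕ → ℤ) → ℤΣ.sum {n} (g ∘ toℕ) ≡ prefixSum n g
sum-toℕ zero    g = refl
sum-toℕ (suc n) g = trans (cong (ℤ._+_ (g 0)) (sum-toℕ n (g ∘ suc))) (sym (prefixSum-front n g))

nonzero : ℕ → ℕ
nonzero zero    = 0
nonzero (suc _) = 1

∣support∣≡sum : ∀ {n} (f : Fin n → ℕ) → ∣ tabulate (λ i → not (f i ℕ.≡ᵇ 0)) ∣ ≡ ℕΣ.sum (nonzero ∘ f)
∣support∣≡sum {zero}  f = refl
∣support∣≡sum {suc n} f with f zero
... | zero  = ∣support∣≡sum (f ∘ suc)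
... | suc _ = cong suc (∣support∣≡sum (f ∘ suc))

sum-const-1 : ∀ n → ℕΣ.sum {n} (λ _ → 1) ≡ n
sum-const-1 zero    = refl
sum-const-1 (suc n) = cong suc (sum-const-1 n)

sum-≥-length : ∀ {n} (f : Fin n → ℕ) → (∀ i → 1 ≤ f i) → n ≤ ℕΣ.sum f
sum-≥-length {zero}  f _  = z≤n
sum-≥-length {suc n} f 1≤f = ℕ.+-mono-≤ (1≤f zero) (sum-≥-length (f ∘ suc) (1≤f ∘ suc))

sum≡length⇒ones : ∀ {n} (f : Fin n → ℕ) → (∀ i → 1 ≤ f i) → ℕΣ.sum f ≡ n → ∀ i → f i ≡ 1
sum≡length⇒ones {suc n} f 1≤f sum≡ = λ
  { zero    → head≡1
  ; (suc i) → sum≡length⇒ones (f ∘ suc) (1≤f ∘ suc) tail≡n i }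
  where
  head≡1 : f zero ≡ 1
  head≡1 = ℕ.≤-antisym (ℕ.+-cancelʳ-≤ n (f zero) 1 (ℕ.≤-trans
             (ℕ.+-monoʳ-≤ (f zero) (sum-≥-length (f ∘ suc) (1≤f ∘ suc))) (ℕ.≤-reflexive sum≡))) (1≤f zero)
  tail≡n : ℕΣ.sum (f ∘ suc) ≡ n
  tail≡n = ℕ.suc-injective (trans (cong (ℕ._+ ℕΣ.sum (f ∘ suc)) (sym head≡1)) sum≡)

oneOddOneZero⇒nonzero≡1 : ∀ {p m} → OneOddOneZero p m → nonzero p ℕ.+ nonzero m ≡ 1
oneOddOneZero⇒nonzero≡1 {suc _} (inj₁ (_ , refl)) = refl
oneOddOneZero⇒nonzero≡1 {_} {suc _} (inj₂ (_ , refl)) = refl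

oneOddOneZero⇒nonzero≥1 : ∀ {p m a b} → OneOddOneZero p m → p ≤ a × m ≤ b → 1 ≤ nonzero a ℕ.+ nonzero b
oneOddOneZero⇒nonzero≥1 {suc _} {a = suc _} (inj₁ _) (s≤s _ , _) = s≤s z≤n
oneOddOneZero⇒nonzero≥1 {m = suc _} {a} {suc _} (inj₂ _) (_ , s≤s _) = ℕ.m≤n+m 1 (nonzero a)

nonzero-sum≡1 : ∀ {a b} → nonzero a ℕ.+ nonzero b ≡ 1 → a ≡ 0 ⊎ b ≡ 0
nonzero-sum≡1 {zero}          _ = inj₁ refl
nonzero-sum≡1 {suc a} {zero}  _ = inj₂ refl

toℤ-isSign : ∀ a → IsSign (toℤ a)
toℤ-isSign ⊕ = inj₁ (inj₁ refl)
toℤ-isSign ⊖ = inj₁ (inj₂ refl)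
toℤ-isSign 𝟘 = inj₂ refl

toℤ-isUnit : ∀ {a} → a ≢ 𝟘 → IsUnit (toℤ a)
toℤ-isUnit {⊕} _   = inj₁ refl
toℤ-isUnit {⊖} _   = inj₂ refl
toℤ-isUnit {𝟘} a≢𝟘 = ⊥-elim (a≢𝟘 refl)

module SymmetricWalk {n} (M : OrientedMatroid (suc n)) (D : Fin (suc n ℕ.+ suc n) → SignVec (suc n))
                     (cycle : SymmetricCycle M D) where

  t : ℕ
  t = suc n

  walk : ℕ → SignVec t
  walk k = D (cyclic k)

  cyclic-↑ˡ : ∀ (k : Fin t) → cyclic (toℕ k) ≡ k ↑ˡ t
  cyclic-↑ˡ k = Fin.toℕ-injective (trans (toℕ-cyclic (toℕ k) (ℕ.<-≤-trans (Fin.toℕ<n k) (ℕ.m≤m+n t t)))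
                                         (sym (Fin.toℕ-↑ˡ k t)))

  cyclic-↑ʳ : ∀ (k : Fin t) → cyclic (t ℕ.+ toℕ k) ≡ t ↑ʳ k
  cyclic-↑ʳ k = Fin.toℕ-injective (trans (toℕ-cyclic (t ℕ.+ toℕ k) (ℕ.+-monoʳ-< t (Fin.toℕ<n k)))
                                         (sym (Fin.toℕ-↑ʳ t k)))

  walk-antipodal′ : ∀ (k : Fin t) → walk (t ℕ.+ toℕ k) ≡ neg (walk (toℕ k))
  walk-antipodal′ k = begin
    D (cyclic (t ℕ.+ toℕ k)) ≡⟨ cong D (cyclic-↑ʳ k) ⟩
    D (t ↑ʳ k)               ≡⟨ proj₂ (proj₂ (proj₂ cycle)) k ⟩
    neg (D (k ↑ˡ t))         ≡⟨ cong (neg ∘ D) (cyclic-↑ˡ k) ⟨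
    neg (walk (toℕ k))       ∎
    where open ≡-Reasoning

  walk-antipodal : ∀ {k} → k ℕ.≤ t → walk (t ℕ.+ k) ≡ neg (walk k)
  walk-antipodal {k} k≤t with ℕ.m≤n⇒m<n∨m≡n k≤t
  ... | inj₁ k<t = subst (λ j → walk (t ℕ.+ j) ≡ neg (walk j)) (Fin.toℕ-fromℕ< k<t) (walk-antipodal′ (fromℕ< k<t))
  ... | inj₂ refl = begin
    D (cyclic (t ℕ.+ t))      ≡⟨ cong D cyclic-wrap ⟩
    walk 0                    ≡⟨ neg-involutive (walk 0) ⟨
    neg (neg (walk 0))        ≡⟨ cong neg (walk-antipodal′ zero) ⟨
    neg (walk (t ℕ.+ 0))      ≡⟨ cong (neg ∘ walk) (ℕ.+-identityʳ t) ⟩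
    neg (walk t)              ∎
    where open ≡-Reasoning

  walk-nonzero : ∀ k e → lookup (walk k) e ≢ 𝟘
  walk-nonzero k = proj₂ (proj₁ cycle (cyclic k))

  flipped : ℕ → Fin t
  flipped k = proj₁ (proj₁ (proj₂ cycle) (cyclic k))

  walk-fixes : ∀ k {e} → flipped k ≢ e → lookup (walk (suc k)) e ≡ lookup (walk k) e
  walk-fixes k flipped≢e = sym (proj₂ (proj₂ (proj₁ (proj₂ cycle) (cyclic k))) _ (flipped≢e ∘ sym))

  walk-flips : ∀ k → lookup (walk (suc k)) (flipped k) ≡ negS (lookup (walk k) (flipped k))
  walk-flips k = nonzero-≢⇒negS (walk-nonzero k _) (walk-nonzero (suc k) _)
                   (proj₁ (proj₂ (proj₁ (proj₂ cycle) (cyclic k))))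

  flipped-onto : ∀ e → ∃ λ (k : Fin t) → flipped (toℕ k) ≡ e
  flipped-onto e with Fin.any? (λ (k : Fin t) → flipped (toℕ k) Fin.≟ e)
  ... | yes flip = flip
  ... | no noFlip = ⊥-elim (negS≢ (walk-nonzero 0 e) (begin
    negS (lookup (walk 0) e)      ≡⟨ Vec.lookup-map e negS (walk 0) ⟨
    lookup (neg (walk 0)) e       ≡⟨ cong (λ v → lookup v e) (walk-antipodal z≤n) ⟨
    lookup (walk (t ℕ.+ 0)) e     ≡⟨ cong (λ j → lookup (walk j) e) (ℕ.+-identityʳ t) ⟩
    lookup (walk t) e             ≡⟨ unchanged ℕ.≤-refl ⟩
    lookup (walk 0) e             ∎))
    where
    open ≡-Reasoning
    unchanged : ∀ {k} → k ℕ.≤ t → lookup (walk k) e ≡ lookup (walk 0) e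
    unchanged {zero}  _     = refl
    unchanged {suc k} k<t = trans (walk-fixes k flipped≢e) (unchanged (ℕ.<⇒≤ k<t))
      where
      flipped≢e : flipped k ≢ e
      flipped≢e eq = noFlip (fromℕ< k<t , trans (cong flipped (Fin.toℕ-fromℕ< k<t)) eq)

  flipTime : Fin t → Fin t
  flipTime e = proj₁ (flipped-onto e)

  flipped-flipTime : ∀ e → flipped (toℕ (flipTime e)) ≡ e
  flipped-flipTime e = proj₂ (flipped-onto e)

  flipTime-flipped : ∀ {k} → k ℕ.< t → toℕ (flipTime (flipped k)) ≡ k
  flipTime-flipped {k} k<t = begin
    toℕ (flipTime (flipped k))                    ≡⟨ cong (toℕ ∘ flipTime ∘ flipped) (Fin.toℕ-fromℕ< k<t) ⟨
    toℕ (flipTime (flipped (toℕ (fromℕ< k<t))))   ≡⟨ cong toℕ (section⇒retraction (flipped ∘ toℕ) flipTime flipped-flipTime _) ⟩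
    toℕ (fromℕ< k<t)                              ≡⟨ Fin.toℕ-fromℕ< k<t ⟩
    k                                             ∎
    where open ≡-Reasoning

  walk-before-flip : ∀ e {k} → k ℕ.≤ toℕ (flipTime e) → lookup (walk k) e ≡ lookup (walk 0) e
  walk-before-flip e {zero}  _   = refl
  walk-before-flip e {suc k} k<f = trans (walk-fixes k flipped≢e) (walk-before-flip e (ℕ.<⇒≤ k<f))
    where
    flipped≢e : flipped k ≢ e
    flipped≢e refl = ℕ.<⇒≢ k<f (sym (flipTime-flipped (ℕ.<-trans k<f (Fin.toℕ<n (flipTime e)))))

  walk-after-flip : ∀ e {k} → toℕ (flipTime e) ℕ.< k → k ℕ.≤ t → lookup (walk k) e ≡ negS (lookup (walk 0) e)
  walk-after-flip e {suc k} f<k+1 k<t with ℕ.m≤n⇒m<n∨m≡n (ℕ.s≤s⁻¹ f<k+1)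
  ... | inj₂ refl = begin
    lookup (walk (suc k)) e           ≡⟨ cong (λ e′ → lookup (walk (suc k)) e′) (flipped-flipTime e) ⟨
    lookup (walk (suc k)) (flipped k) ≡⟨ walk-flips k ⟩
    negS (lookup (walk k) (flipped k)) ≡⟨ cong (λ e′ → negS (lookup (walk k) e′)) (flipped-flipTime e) ⟩
    negS (lookup (walk k) e)          ≡⟨ cong negS (walk-before-flip e ℕ.≤-refl) ⟩
    negS (lookup (walk 0) e)          ∎
    where open ≡-Reasoning
  ... | inj₁ f<k = trans (walk-fixes k flipped≢e) (walk-after-flip e f<k (ℕ.<⇒≤ k<t))
    where
    flipped≢e : flipped k ≢ e
    flipped≢e refl = ℕ.<⇒≢ f<k (flipTime-flipped k<t)

  subtope : ℕ → SignVec t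
  subtope k = meet (walk k) (walk (suc k))

  subtope-coordinate : ∀ e {k} → k ℕ.< t →
    toℤ (lookup (subtope k) e) ≡ toℤ (lookup (walk 0) e) ℤ.* sign[ toℕ (flipTime e) - k ]
  subtope-coordinate e {k} k<t
    rewrite Vec.lookup-zipWith meetS e (walk k) (walk (suc k))
    with ℕ.<-cmp k (toℕ (flipTime e))
  ... | tri< k<f _ _
    rewrite walk-before-flip e (ℕ.<⇒≤ k<f) | walk-before-flip e k<f | sign-< k<f
          | meetS-idem (lookup (walk 0) e) = sym (ℤ.*-identityʳ _)
  ... | tri≈ _ refl _
    rewrite walk-before-flip e {k} ℕ.≤-refl | walk-after-flip e ℕ.≤-refl k<t | sign-≡ k
          | meetS-negSʳ (lookup (walk 0) e) = sym (ℤ.*-zeroʳ (toℤ (lookup (walk 0) e)))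
  ... | tri> _ _ f<k
    rewrite walk-after-flip e f<k (ℕ.<⇒≤ k<t) | walk-after-flip e (ℕ.<-trans f<k (ℕ.n<1+n k)) k<t | sign-> f<k
          | meetS-idem (negS (lookup (walk 0) e)) | toℤ-negS (lookup (walk 0) e) =
    trans (sym (ℤ.-1*i≡-i _)) (ℤ.*-comm -1ℤ _)

  subtope-antipodal : ∀ {k} → k ℕ.< t → subtope (t ℕ.+ k) ≡ neg (subtope k)
  subtope-antipodal {k} k<t = begin
    meet (walk (t ℕ.+ k)) (walk (suc (t ℕ.+ k)))     ≡⟨ cong (meet (walk (t ℕ.+ k)) ∘ walk) (ℕ.+-suc t k) ⟨
    meet (walk (t ℕ.+ k)) (walk (t ℕ.+ suc k))       ≡⟨ cong₂ meet (walk-antipodal (ℕ.<⇒≤ k<t)) (walk-antipodal k<t) ⟩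
    meet (neg (walk k)) (neg (walk (suc k)))         ≡⟨ meet-neg (walk k) (walk (suc k)) ⟩
    neg (subtope k)                                  ∎
    where open ≡-Reasoning

  -- the coefficient of S^k minus that of S^{t+k} = -S^k
  net : Coeffs t → ℕ → ℤ
  net c j = + c (cyclic j) - + c (cyclic (t ℕ.+ j))

  net-↑ : ∀ c (k : Fin t) → net c (toℕ k) ≡ + c (k ↑ˡ t) - + c (t ↑ʳ k)
  net-↑ c k = cong₂ (λ i j → + c i - + c j) (cyclic-↑ˡ k) (cyclic-↑ʳ k)

  sign₀ : Fin t → ℤ
  sign₀ e = toℤ (lookup (walk 0) e)

  sign₀² : ∀ e → sign₀ e ℤ.* sign₀ e ≡ 1ℤ
  sign₀² e with lookup (walk 0) e | walk-nonzero 0 e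
  ... | ⊕ | _ = refl
  ... | ⊖ | _ = refl
  ... | 𝟘 | 𝟘≢𝟘 with () ← 𝟘≢𝟘 refl

  subtopeSeq-↑ˡ : ∀ (k : Fin t) → subtopeSeq D (k ↑ˡ t) ≡ subtope (toℕ k)
  subtopeSeq-↑ˡ k = cong (subtopeSeq D) (sym (cyclic-↑ˡ k))

  subtopeSeq-↑ʳ : ∀ (k : Fin t) → subtopeSeq D (t ↑ʳ k) ≡ neg (subtope (toℕ k))
  subtopeSeq-↑ʳ k = trans (cong (subtopeSeq D) (sym (cyclic-↑ʳ k))) (subtope-antipodal (Fin.toℕ<n k))

  representation-coordinate : ∀ c e →
    sumℤ (λ i → + c i ℤ.* toℤ (lookup (subtopeSeq D i) e))
      ≡ signedSum t (net c) (toℕ (flipTime e)) ℤ.* sign₀ e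
  representation-coordinate c e = begin
    sumℤ term                                                   ≡⟨ sumℤ≡sum term ⟩
    ℤΣ.sum term                                                 ≡⟨ sum-↑ ℤ.+-0-monoid t term ⟩
    ℤΣ.sum {t} (term ∘ (_↑ˡ t)) ℤ.+ ℤΣ.sum {t} (term ∘ (t ↑ʳ_))  ≡⟨ ℤΣ.∑-distrib-+ {t} (term ∘ (_↑ˡ t)) (term ∘ (t ↑ʳ_)) ⟨
    ℤΣ.sum {t} (λ k → term (k ↑ˡ t) ℤ.+ term (t ↑ʳ k))          ≡⟨ ℤΣ.sum-cong-≗ paired ⟩
    ℤΣ.sum {t} (λ k → row k ℤ.* sign₀ e)                        ≡⟨ ℤΣ.*-distribʳ-sum {t} (sign₀ e) row ⟨
    ℤΣ.sum {t} row ℤ.* sign₀ e                                  ≡⟨ cong (ℤ._* sign₀ e) (sum-toℕ t _) ⟩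
    signedSum t (net c) f ℤ.* sign₀ e                           ∎
    where
    open ≡-Reasoning
    f : ℕ
    f = toℕ (flipTime e)
    term : Fin (t ℕ.+ t) → ℤ
    term i = + c i ℤ.* toℤ (lookup (subtopeSeq D i) e)
    row : Fin t → ℤ
    row k = net c (toℕ k) ℤ.* sign[ f - toℕ k ]
    paired : ∀ k → term (k ↑ˡ t) ℤ.+ term (t ↑ʳ k) ≡ row k ℤ.* sign₀ e
    paired k = begin
      term (k ↑ˡ t) ℤ.+ term (t ↑ʳ k)
        ≡⟨ cong₂ (λ u v → + c (k ↑ˡ t) ℤ.* toℤ (lookup u e) ℤ.+ + c (t ↑ʳ k) ℤ.* toℤ (lookup v e))
                 (subtopeSeq-↑ˡ k) (subtopeSeq-↑ʳ k) ⟩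
      + c (k ↑ˡ t) ℤ.* toℤ (lookup S e) ℤ.+ + c (t ↑ʳ k) ℤ.* toℤ (lookup (neg S) e)
        ≡⟨ cong (λ s → + c (k ↑ˡ t) ℤ.* toℤ (lookup S e) ℤ.+ + c (t ↑ʳ k) ℤ.* s)
                (trans (cong toℤ (Vec.lookup-map e negS S)) (toℤ-negS (lookup S e))) ⟩
      + c (k ↑ˡ t) ℤ.* toℤ (lookup S e) ℤ.+ + c (t ↑ʳ k) ℤ.* - toℤ (lookup S e)
        ≡⟨ cong (λ s → + c (k ↑ˡ t) ℤ.* s ℤ.+ + c (t ↑ʳ k) ℤ.* - s) (subtope-coordinate e (Fin.toℕ<n k)) ⟩
      + c (k ↑ˡ t) ℤ.* (sign₀ e ℤ.* σ) ℤ.+ + c (t ↑ʳ k) ℤ.* - (sign₀ e ℤ.* σ)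
        ≡⟨ collect (+ c (k ↑ˡ t)) (+ c (t ↑ʳ k)) (sign₀ e) σ ⟩
      (+ c (k ↑ˡ t) - + c (t ↑ʳ k)) ℤ.* σ ℤ.* sign₀ e
        ≡⟨ cong (λ b → b ℤ.* σ ℤ.* sign₀ e) (net-↑ c k) ⟨
      net c (toℕ k) ℤ.* σ ℤ.* sign₀ e ∎
      where
      S : SignVec t
      S = subtope (toℕ k)
      σ : ℤ
      σ = sign[ f - toℕ k ]
      collect : ∀ a b s σ → a ℤ.* (s ℤ.* σ) ℤ.+ b ℤ.* - (s ℤ.* σ) ≡ (a - b) ℤ.* σ ℤ.* s
      collect = solve-∀

  -- Represents D c x is the system signedSum t (net c) ≡ target x, with the coordinates of x
  -- ordered by flip time and normalised by the signs of D^0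
  target : SignVec t → ℕ → ℤ
  target x m = sign₀ (flipped m) ℤ.* toℤ (lookup x (flipped m))

  represents⇒solves : ∀ {c x} → Represents D c x → ∀ {m} → m ℕ.< t → signedSum t (net c) m ≡ target x m
  represents⇒solves {c} {x} represents {m} m<t = begin
    signedSum t (net c) m                               ≡⟨ ℤ.*-identityʳ _ ⟨
    signedSum t (net c) m ℤ.* 1ℤ                        ≡⟨ cong (signedSum t (net c) m ℤ.*_) (sign₀² e) ⟨
    signedSum t (net c) m ℤ.* (sign₀ e ℤ.* sign₀ e)     ≡⟨ reassociate (signedSum t (net c) m) (sign₀ e) ⟩
    sign₀ e ℤ.* (signedSum t (net c) m ℤ.* sign₀ e)     ≡⟨ cong (λ j → sign₀ e ℤ.* (signedSum t (net c) j ℤ.* sign₀ e))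
                                                              (flipTime-flipped m<t) ⟨
    sign₀ e ℤ.* (signedSum t (net c) (toℕ (flipTime e)) ℤ.* sign₀ e)
                                                        ≡⟨ cong (sign₀ e ℤ.*_) (representation-coordinate c e) ⟨
    sign₀ e ℤ.* sumℤ (λ i → + c i ℤ.* toℤ (lookup (subtopeSeq D i) e))
                                                        ≡⟨ cong (sign₀ e ℤ.*_) (represents e) ⟩
    target x m                                          ∎
    where
    open ≡-Reasoning
    e : Fin t
    e = flipped m
    reassociate : ∀ a s → a ℤ.* (s ℤ.* s) ≡ s ℤ.* (a ℤ.* s)
    reassociate = solve-∀

  solves⇒represents : ∀ {c x} → (∀ {m} → m ℕ.< t → signedSum t (net c) m ≡ target x m) → Represents D c x
  solves⇒represents {c} {x} solves e = begin
    sumℤ (λ i → + c i ℤ.* toℤ (lookup (subtopeSeq D i) e))    ≡⟨ representation-coordinate c e ⟩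
    signedSum t (net c) f ℤ.* sign₀ e                           ≡⟨ cong (ℤ._* sign₀ e) (solves (Fin.toℕ<n (flipTime e))) ⟩
    target x f ℤ.* sign₀ e                                      ≡⟨ cong (λ e′ → sign₀ e′ ℤ.* toℤ (lookup x e′) ℤ.* sign₀ e)
                                                                     (flipped-flipTime e) ⟩
    sign₀ e ℤ.* toℤ (lookup x e) ℤ.* sign₀ e                    ≡⟨ reassociate (sign₀ e) (toℤ (lookup x e)) ⟩
    toℤ (lookup x e) ℤ.* (sign₀ e ℤ.* sign₀ e)                  ≡⟨ cong (toℤ (lookup x e) ℤ.*_) (sign₀² e) ⟩
    toℤ (lookup x e) ℤ.* 1ℤ                                     ≡⟨ ℤ.*-identityʳ _ ⟩
    toℤ (lookup x e)                                            ∎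
    where
    open ≡-Reasoning
    f : ℕ
    f = toℕ (flipTime e)
    reassociate : ∀ s a → s ℤ.* a ℤ.* s ≡ a ℤ.* (s ℤ.* s)
    reassociate = solve-∀

  module Coefficients (even : isOddℤ t ≡ 0ℤ) where

    netSolution : SignVec t → Fin t → ℤ
    netSolution x k = solution (target x) t (toℕ k)

    coefficients : SignVec t → Coeffs t
    coefficients x = (posPart ∘ netSolution x) ++ (negPart ∘ netSolution x)

    coefficients-↑ˡ : ∀ x k → coefficients x (k ↑ˡ t) ≡ posPart (netSolution x k)
    coefficients-↑ˡ x k = lookup-++ˡ (posPart ∘ netSolution x) (negPart ∘ netSolution x) k

    coefficients-↑ʳ : ∀ x k → coefficients x (t ↑ʳ k) ≡ negPart (netSolution x k)
    coefficients-↑ʳ x k = lookup-++ʳ (posPart ∘ netSolution x) (negPart ∘ netSolution x) k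

    target-isSign : ∀ x m → IsSign (target x m)
    target-isSign x m = isUnit-*-isSign (toℤ-isUnit (walk-nonzero 0 (flipped m))) (toℤ-isSign _)

    target-isUnit : ∀ {x} → (∀ e → lookup x e ≢ 𝟘) → ∀ m → IsUnit (target x m)
    target-isUnit x≢𝟘 m = isUnit-* (toℤ-isUnit (walk-nonzero 0 (flipped m))) (toℤ-isUnit (x≢𝟘 (flipped m)))

    net-unique : ∀ c x → Represents D c x → ∀ k → + c (k ↑ˡ t) - + c (t ↑ʳ k) ≡ netSolution x k
    net-unique c x represents k =
      trans (sym (net-↑ c k)) (solution-unique (target x) t (net c) even (represents⇒solves {c} {x} represents) (Fin.toℕ<n k))

    net-coefficients : ∀ x k → + coefficients x (k ↑ˡ t) - + coefficients x (t ↑ʳ k) ≡ netSolution x k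
    net-coefficients x k = trans (cong₂ (λ a b → + a - + b) (coefficients-↑ˡ x k) (coefficients-↑ʳ x k))
                                 (sym (posPart-negPart (netSolution x k)))

    coefficients-represent : ∀ x → Represents D (coefficients x) x
    coefficients-represent x = solves⇒represents {coefficients x} {x} λ {m} m<t →
      trans (signedSum-cong t m net≡) (solution-solves (target x) t even m<t)
      where
      net≡ : ∀ {j} → j ℕ.< t → net (coefficients x) j ≡ solution (target x) t j
      net≡ j<t = subst (λ j → net (coefficients x) j ≡ solution (target x) t j) (Fin.toℕ-fromℕ< j<t)
                       (trans (net-↑ (coefficients x) (fromℕ< j<t)) (net-coefficients x (fromℕ< j<t)))

    coefficients-elim : ∀ x (Q : ℕ → Set) → (∀ k → Q (posPart (netSolution x k))) → (∀ k → Q (negPart (netSolution x k))) →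
                        ∀ i → Q (coefficients x i)
    coefficients-elim x Q left right = ↑-elim t (Q ∘ coefficients x)
      (λ k → subst Q (sym (coefficients-↑ˡ x k)) (left k))
      (λ k → subst Q (sym (coefficients-↑ʳ x k)) (right k))

    coefficients-bounded : ∀ x → Bounded {t} (coefficients x)
    coefficients-bounded x = coefficients-elim x (λ v → v ≡ 0 ⊎ (1 ℕ.≤ v × v ℕ.≤ t ∸ 1))
      (λ k → bounded (ℕ.≤-trans (posPart≤∣x∣ (netSolution x k)) (netSolution-bound k)))
      (λ k → bounded (ℕ.≤-trans (negPart≤∣x∣ (netSolution x k)) (netSolution-bound k)))
      where
      bounded : ∀ {v m} → v ℕ.≤ m → v ≡ 0 ⊎ (1 ℕ.≤ v × v ℕ.≤ m)
      bounded {zero}  _   = inj₁ refl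
      bounded {suc v} v≤m = inj₂ (s≤s z≤n , v≤m)
      netSolution-bound : ∀ k → ℤ.∣ netSolution x k ∣ ℕ.≤ t ∸ 1
      netSolution-bound k = SumOf-signs (SumOf-solution isSign-neg (target-isSign x) (Fin.toℕ<n k))

    coefficients-unique : ∀ c x → Represents D c x → (∀ k → c (k ↑ˡ t) ≡ 0 ⊎ c (t ↑ʳ k) ≡ 0) →
                          ∀ i → c i ≡ coefficients x i
    coefficients-unique c x represents oneZero = ↑-elim t (λ i → c i ≡ coefficients x i)
      (λ k → trans (sym (proj₁ (parts k))) (sym (coefficients-↑ˡ x k)))
      (λ k → trans (sym (proj₂ (parts k))) (sym (coefficients-↑ʳ x k)))
      where
      parts : ∀ k → posPart (netSolution x k) ≡ c (k ↑ˡ t) × negPart (netSolution x k) ≡ c (t ↑ʳ k)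
      parts k = parts-unique (oneZero k) (sym (net-unique c x represents k))

    coefficients-minimal : ∀ c x → Represents D c x → SuppSub {t} (coefficients x) c
    coefficients-minimal c x represents = ↑-elim t (λ i → coefficients x i ≢ 0 → c i ≢ 0)
      (λ k c₀≢0 c≡0 → c₀≢0 (trans (coefficients-↑ˡ x k) (ℕ.n≤0⇒n≡0 (subst (_ ℕ.≤_) c≡0 (proj₁ (bounds k))))))
      (λ k c₀≢0 c≡0 → c₀≢0 (trans (coefficients-↑ʳ x k) (ℕ.n≤0⇒n≡0 (subst (_ ℕ.≤_) c≡0 (proj₂ (bounds k))))))
      where
      bounds : ∀ k → posPart (netSolution x k) ℕ.≤ c (k ↑ˡ t) × negPart (netSolution x k) ℕ.≤ c (t ↑ʳ k)
      bounds k = parts-≤ (c (k ↑ˡ t)) (c (t ↑ʳ k)) (sym (net-unique c x represents k))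

    coefficients-MinimalRepSub : ∀ x → MinimalRepSub D x (coefficients x)
    coefficients-MinimalRepSub x =
      (coefficients-bounded x , coefficients-represent x) , λ c (_ , represents) _ → coefficients-minimal c x represents

    MinimalRepSub-unique : ∀ c x → MinimalRepSub D x c → ∀ i → c i ≡ coefficients x i
    MinimalRepSub-unique c x ((_ , represents) , minimal) = coefficients-unique c x represents oneZero
      where
      c⊆c₀ : SuppSub {t} c (coefficients x)
      c⊆c₀ = minimal (coefficients x) (coefficients-bounded x , coefficients-represent x) (coefficients-minimal c x represents)
      outside : ∀ i → coefficients x i ≡ 0 → c i ≡ 0
      outside i c₀≡0 with c i in eq
      ... | zero  = refl
      ... | suc _ = ⊥-elim (c⊆c₀ i (λ c≡0 → ℕ.0≢1+n (trans (sym c≡0) eq)) c₀≡0)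
      oneZero : ∀ k → c (k ↑ˡ t) ≡ 0 ⊎ c (t ↑ʳ k) ≡ 0
      oneZero k with posPart≡0⊎negPart≡0 (netSolution x k)
      ... | inj₁ p≡0 = inj₁ (outside (k ↑ˡ t) (trans (coefficients-↑ˡ x k) p≡0))
      ... | inj₂ n≡0 = inj₂ (outside (t ↑ʳ k) (trans (coefficients-↑ʳ x k) n≡0))

    pairCount : Coeffs t → Fin t → ℕ
    pairCount c k = nonzero (c (k ↑ˡ t)) ℕ.+ nonzero (c (t ↑ʳ k))

    ∣support∣≡sum-pairCount : ∀ c → ∣ support {t} c ∣ ≡ ℕΣ.sum (pairCount c)
    ∣support∣≡sum-pairCount c = trans (∣support∣≡sum c)
      (trans (sum-↑ ℕ.+-0-monoid t (nonzero ∘ c)) (sym (ℕΣ.∑-distrib-+ (nonzero ∘ c ∘ (_↑ˡ t)) (nonzero ∘ c ∘ (t ↑ʳ_)))))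

    module _ (odd : n % 2 ≡ 1) (x : SignVec t) (x≢𝟘 : ∀ e → lookup x e ≢ 𝟘) where

      netSolution-odd : ∀ k → OneOddOneZero (posPart (netSolution x k)) (negPart (netSolution x k))
      netSolution-odd k = SumOf-odd-units (SumOf-solution isUnit-neg (target-isUnit {x} x≢𝟘) (Fin.toℕ<n k)) odd

      coefficients-RepTope : RepTope D x (coefficients x)
      coefficients-RepTope = coefficients-bounded x , coefficients-represent x , card , coefficients-odd
        where
        pairCount≡1 : ∀ k → pairCount (coefficients x) k ≡ 1
        pairCount≡1 k = trans (cong₂ (λ a b → nonzero a ℕ.+ nonzero b)
                                     (coefficients-↑ˡ x k)
                                     (coefficients-↑ʳ x k))
                              (oneOddOneZero⇒nonzero≡1 (netSolution-odd k))
        card : ∣ support {t} (coefficients x) ∣ ≡ t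
        card = trans (∣support∣≡sum-pairCount (coefficients x)) (trans (ℕΣ.sum-cong-≗ pairCount≡1) (sum-const-1 t))
        coefficients-odd : ∀ i → coefficients x i ≢ 0 → coefficients x i % 2 ≡ 1
        coefficients-odd = coefficients-elim x (λ v → v ≢ 0 → v % 2 ≡ 1)
          (λ k p≢0 → [ proj₁ , (λ (_ , p≡0) → ⊥-elim (p≢0 p≡0)) ]′ (netSolution-odd k))
          (λ k n≢0 → [ (λ (_ , n≡0) → ⊥-elim (n≢0 n≡0)) , proj₁ ]′ (netSolution-odd k))

      RepTope-unique : ∀ c → RepTope D x c → ∀ i → c i ≡ coefficients x i
      RepTope-unique c (_ , represents , card , _) = coefficients-unique c x represents oneZero
        where
        pairCount≥1 : ∀ k → 1 ℕ.≤ pairCount c k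
        pairCount≥1 k = oneOddOneZero⇒nonzero≥1 (netSolution-odd k)
                          (parts-≤ (c (k ↑ˡ t)) (c (t ↑ʳ k)) (sym (net-unique c x represents k)))
        oneZero : ∀ k → c (k ↑ˡ t) ≡ 0 ⊎ c (t ↑ʳ k) ≡ 0
        oneZero k = nonzero-sum≡1 (sum≡length⇒ones (pairCount c) pairCount≥1
                      (trans (sym (∣support∣≡sum-pairCount c)) card) k)

even⇒double : ∀ t → t % 2 ≡ 0 → ∃ λ h → t ≡ h * 2
even⇒double t t%2≡0 = t / 2 , trans (m≡m%n+[m/n]*n t 2) (cong (_+ (t / 2) * 2) t%2≡0)

proposition3p1 : (t : ℕ) → 4 ≤ t → t % 2 ≡ 0 →
    (M : OrientedMatroid t) → Simple M →
    (D : Fin (t + t) → SignVec t) → SymmetricCycle M D →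
    (∀ T → Tope M T →
       ∃ λ c → RepTope D T c × (∀ c' → RepTope D T c' → ∀ k → c' k ≡ c k))
    ×
    (∀ S → Subtope M S →
       ∃ λ c → MinimalRepSub D S c × (∀ c' → MinimalRepSub D S c' → ∀ k → c' k ≡ c k))
proposition3p1 (suc n) _ t%2≡0 M _ D cycle with even⇒double (suc n) t%2≡0
... | suc h , t≡2h+2 =
  (λ T tope → coefficients T , coefficients-RepTope pred-odd T (proj₂ tope) , λ c → RepTope-unique pred-odd T (proj₂ tope) c) ,
  (λ S _ → coefficients S , coefficients-MinimalRepSub S , λ c → MinimalRepSub-unique c S)
  where
  even : isOddℤ (suc n) ≡ 0ℤ
  even = subst (λ m → isOddℤ m ≡ 0ℤ) (sym t≡2h+2) (isOddℤ-even (suc h))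
  pred-odd : n % 2 ≡ 1
  pred-odd = trans (cong (_% 2) (ℕ.suc-injective t≡2h+2)) ([m+kn]%n≡m%n 1 h 2)
  open SymmetricWalk M D cycle
  open Coefficients even
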